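{- Let $f$ be a subhomogeneous time bound and let $A$ be an $f$-complete language. Then $\mathrm{DTIME}(f)=\mathrm{NTIME}(f)$ if and only if $A\in\mathrm{DTIME}(f)$; and $\mathrm{NTIME}(f)=\mathrm{coNTIME}(f)$ if and only if $A\in\mathrm{coNTIME}(f)$.
   Context: A time bound is a function $f:\mathbb{N}\to\mathbb{N}$ with $n\le f(n)\le f(n+1)$ for all $n$. Turing machines (DTM deterministic, NTM nondeterministic) have a separate read-only input tape and finitely many work tapes. $\mathrm{DTIME}(f)$ (resp. $\mathrm{NTIME}(f)$) is the class of languages $L\subseteq\{0,1\}^*$ accepted by some DTM (resp. NTM) with time complexity in $O(f)$; $\mathrm{coNTIME}(f)$ is the class of complements of languages in $\mathrm{NTIME}(f)$. $f$ is subhomogeneous if for every $c\in\mathbb{N}_{+}$ there is $\bar c\in\mathbb{N}_{+}$ with $f(cn)\le\bar c f(n)$ for all $n\in\mathbb{N}_{+}$. A language $A$ is $f$-complete if $A\in\mathrm{NTIME}(f)$ and for every $L\in\mathrm{NTIME}(f)$ there is a function $\rho$ computable by a DTM in linear time with $w\in L\iff\rho(w)\in A$ for all $w$. -}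

module Defs where

open import Data.Nat using (ℕ; zero; suc; _+_; _*_; _≤_)
open import Data.Bool using (Bool; true; false; not)
open import Data.List using (List; []; _∷_; length; map)
open import Data.List.Membership.Propositional using (_∈_)
open import Data.Maybe using (Maybe; just; nothing)
open import Data.Vec using (Vec; []; _∷_; replicate) renaming (map to vmap)
open import Data.Fin using (Fin; zero; suc)
open import Data.Product using (Σ; _×_; _,_; ∃)
open import Function using (_∘_)
open import Function.Bundles using (_⇔_)
open import Relation.Binary.PropositionalEquality using (_≡_)
open import Relation.Nullary using (¬_)

-- false = 0, true = 1
Word : Set
Word = List Bool

Language : Set
Language = Word → Bool

TimeBound : (ℕ → ℕ) → Set
TimeBound f = (∀ n → n ≤ f n) × (∀ n → f n ≤ f (suc n))

Subhomogeneous : (ℕ → ℕ) → Set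
Subhomogeneous f =
  ∀ c → 1 ≤ c → Σ ℕ λ c̄ → 1 ≤ c̄ × (∀ n → 1 ≤ n → f (c * n) ≤ c̄ * f n)

-- Tapes.  Work-tape alphabet Γ = Fin (3 + g): symbol 0 is the blank,
-- symbols 1 and 2 stand for the bits 0 and 1 (used for output), the
-- remaining g symbols are arbitrary extra symbols.

Sym : ℕ → Set
Sym g = Fin (3 + g)

blank : ∀ {g} → Sym g
blank = zero

data Move : Set where
  Lm Sm Rm : Move

-- two-way infinite tape as a zipper (unwritten cells are blank)
record Tape (g : ℕ) : Set where
  constructor tape
  field
    left  : List (Sym g)   -- cells left of the head, nearest first
    head  : Sym g
    right : List (Sym g)   -- cells right of the head, nearest first
open Tape public

emptyTape : ∀ {g} → Tape g
emptyTape = tape [] blank []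

moveTape : ∀ {g} → Move → Tape g → Tape g
moveTape Lm (tape [] h r)      = tape [] blank (h ∷ r)
moveTape Lm (tape (x ∷ l) h r) = tape l x (h ∷ r)
moveTape Sm t                  = t
moveTape Rm (tape l h [])      = tape (h ∷ l) blank []
moveTape Rm (tape l h (x ∷ r)) = tape (h ∷ l) x r

writeTape : ∀ {g} → Sym g → Tape g → Tape g
writeTape a (tape l _ r) = tape l a r

updTapes : ∀ {g k} → Vec (Sym g) k → Vec Move k → Vec (Tape g) k → Vec (Tape g) k
updTapes []       []       []       = []
updTapes (a ∷ as) (m ∷ ms) (t ∷ ts) = moveTape m (writeTape a t) ∷ updTapes as ms ts

-- read-only input tape: cells 0 .. |w|-1 hold the input, all others blank
readIn : Word → ℕ → Maybe Bool
readIn []      _       = nothing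
readIn (b ∷ w) zero    = just b
readIn (b ∷ w) (suc i) = readIn w i

moveIn : Move → ℕ → ℕ
moveIn Lm zero    = zero
moveIn Lm (suc i) = i
moveIn Sm i       = i
moveIn Rm i       = suc i

record Config (k g q : ℕ) : Set where
  constructor config
  field
    state : Fin (suc q)
    inPos : ℕ
    tapes : Vec (Tape g) k
open Config public

Action : (k g q : ℕ) → Set
Action k g q = Fin (suc q) × Vec (Sym g) k × Move × Vec Move k

applyAction : ∀ {k g q} → Config k g q → Action k g q → Config k g q
applyAction (config _ i ts) (s , ws , m , ms) = config s (moveIn m i) (updTapes ws ms ts)

-- Nondeterministic Turing machines.  A configuration with no possible
-- transition is halting; the machine accepts w iff some computation on w
-- halts in an accepting state.

record NTM : Set where
  field
    k g q     : ℕ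
    start     : Fin (suc q)
    accepting : Fin (suc q) → Bool
    δ         : Fin (suc q) → Maybe Bool → Vec (Sym g) k → List (Action k g q)

module _ (M : NTM) where
  open NTM M

  NConf : Set
  NConf = Config k g q

  initN : NConf
  initN = config start 0 (replicate k emptyTape)

  nextN : Word → NConf → List NConf
  nextN w c = map (applyAction c) (δ (state c) (readIn w (inPos c)) (vmap head (tapes c)))

  data PathN (w : Word) : ℕ → NConf → NConf → Set where
    done : ∀ {c} → PathN w 0 c c
    step : ∀ {n c c₁ c₂} → c₁ ∈ nextN w c → PathN w n c₁ c₂ → PathN w (suc n) c c₂

  HaltedN : Word → NConf → Set
  HaltedN w c = nextN w c ≡ []

  AcceptsN : Word → Set
  AcceptsN w = Σ ℕ λ n → Σ NConf λ c →
    PathN w n initN c × HaltedN w c × accepting (state c) ≡ true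

  -- every computation on w halts within t steps
  WithinN : Word → ℕ → Set
  WithinN w t = ∀ c → ¬ PathN w (suc t) initN c

record DTM : Set where
  field
    k g q     : ℕ
    start     : Fin (suc q)
    accepting : Fin (suc q) → Bool
    δ         : Fin (suc q) → Maybe Bool → Vec (Sym g) k → Maybe (Action k g q)

-- decode the output: cells from the head rightwards up to the first
-- cell not holding a bit symbol (1 ↦ bit 0, 2 ↦ bit 1)
decode : ∀ {g} → List (Sym g) → List Bool
decode []                     = []
decode (zero ∷ _)             = []
decode (suc zero ∷ xs)        = false ∷ decode xs
decode (suc (suc zero) ∷ xs)  = true ∷ decode xs
decode (suc (suc (suc _)) ∷ _) = []

-- output convention: content of the first work tape (a machine without
-- work tapes outputs the empty word)
outputTapes : ∀ {g k} → Vec (Tape g) k → Word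
outputTapes []               = []
outputTapes (tape _ h r ∷ _) = decode (h ∷ r)

module _ (M : DTM) where
  open DTM M

  DConf : Set
  DConf = Config k g q

  initD : DConf
  initD = config start 0 (replicate k emptyTape)

  stepD : Word → DConf → Maybe DConf
  stepD w c with δ (state c) (readIn w (inPos c)) (vmap head (tapes c))
  ... | nothing = nothing
  ... | just a  = just (applyAction c a)

  -- the configuration after n steps (or the halting configuration if
  -- the machine halts earlier)
  runD : Word → ℕ → DConf → DConf
  runD w zero    c = c
  runD w (suc n) c with stepD w c
  ... | nothing = c
  ... | just c' = runD w n c'

  HaltedD : Word → DConf → Set
  HaltedD w c = stepD w c ≡ nothing

  AcceptsD : Word → Set
  AcceptsD w = Σ ℕ λ n →
    HaltedD w (runD w n initD) × accepting (state (runD w n initD)) ≡ true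

  WithinD : Word → ℕ → Set
  WithinD w t = HaltedD w (runD w t initD)

  outputD : Word → ℕ → Word
  outputD w t = outputTapes (tapes (runD w t initD))

-- Complexity classes.  "time complexity in O(f)": there is c with every
-- computation on every input w halting within c·f(|w|) + c steps.

Class : Set₁
Class = Language → Set

DTIME : (ℕ → ℕ) → Class
DTIME f L = Σ DTM λ M →
  (∀ w → (L w ≡ true) ⇔ AcceptsD M w) ×
  (Σ ℕ λ c → ∀ w → WithinD M w (c * f (length w) + c))

NTIME : (ℕ → ℕ) → Class
NTIME f L = Σ NTM λ M →
  (∀ w → (L w ≡ true) ⇔ AcceptsN M w) ×
  (Σ ℕ λ c → ∀ w → WithinN M w (c * f (length w) + c))

coNTIME : (ℕ → ℕ) → Class
coNTIME f L = NTIME f (not ∘ L)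

_≐_ : Class → Class → Set
C ≐ D = ∀ L → C L ⇔ D L

LinearTimeComputable : (Word → Word) → Set
LinearTimeComputable ρ = Σ DTM λ T → Σ ℕ λ c → ∀ w →
  WithinD T w (c * length w + c) × outputD T w (c * length w + c) ≡ ρ w

Complete : (ℕ → ℕ) → Language → Set
Complete f A = NTIME f A ×
  (∀ L → NTIME f L → Σ (Word → Word) λ ρ →
     LinearTimeComputable ρ × (∀ w → L w ≡ A (ρ w)))

module Submission where

-- Idea: if A is f-complete, every L ∈ NTIME(f) reduces to A by a linear-time ρ, so both
-- equivalences follow once DTIME(f) and NTIME(f) are known to be closed under linear-time
-- reductions (for coNTIME, reduce L and not ∘ L to A and use not ∘ A ∈ NTIME(f)).
-- Closure is by composing machines: run the transducer T computing ρ, copy its output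
-- onto a fresh tape whose first cell is marked, rewind, and simulate the machine for the
-- target language with that tape as its read-only input; the mark turns a left move at
-- cell 0 into a stay.  The copy is at most one cell longer than T's running time
-- c|w| + c, so subhomogeneity of f bounds the simulation time by O(f(|w|)).  When the
-- simulated machine is deterministic, the same transition table yields a DTM.

open import Defs
open import Data.Bool using (Bool; true; false; not)
open import Data.Bool.Properties using (not-involutive)
open import Data.Empty using (⊥-elim)
open import Data.Fin using (Fin; zero; suc; _↑ˡ_; _↑ʳ_; splitAt)
open import Data.Fin.Properties using (splitAt-↑ˡ; splitAt-↑ʳ)
open import Data.List as L using (List; []; _∷_; [_]; length; drop; fromMaybe)
open import Data.List.Membership.Propositional using (_∈_)
open import Data.List.Membership.Propositional.Properties using (∈-map⁺; ∈-map⁻)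
open import Data.List.Properties using (map-∘)
open import Data.List.Relation.Unary.Any using (here)
open import Data.Maybe as Maybe using (Maybe; just; nothing)
open import Data.Maybe.Properties using (just-injective)
open import Data.Nat using (ℕ; zero; suc; _+_; _*_; _≤_; _≤′_; ≤′-refl; ≤′-step; z≤n; s≤s)
open import Data.Nat.Properties
open import Data.Nat.Solver using (module +-*-Solver)
open import Data.Product using (Σ; _×_; _,_; proj₁; proj₂)
open import Data.Sum using ([_,_]′)
open import Data.Vec as V using (Vec; []; _∷_; _++_; replicate)
open import Data.Vec.Properties using (map-++; map-replicate; ++-injectiveˡ; ++-injectiveʳ)
open import Function using (_∘_)
open import Function.Bundles using (_⇔_; mk⇔; Equivalence)
import Function.Properties.Equivalence as ⇔
open import Relation.Binary.PropositionalEquality hiding ([_])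

module Paths (N : NTM) (w : Word) where

  PathN-++ : ∀ {x y z n m} → PathN N w n x y → PathN N w m y z → PathN N w (n + m) x z
  PathN-++ done q = q
  PathN-++ (step e p) q = step e (PathN-++ p q)

  PathN-unsnoc : ∀ {n x z} → PathN N w (suc n) x z → Σ (NConf N) λ y → PathN N w n x y × z ∈ nextN N w y
  PathN-unsnoc (step m done) = _ , done , m
  PathN-unsnoc (step m (step m' p)) with PathN-unsnoc (step m' p)
  ... | y , q , m'' = y , step m q , m''

  PathN-prefix : ∀ {x z} n m → PathN N w (n + m) x z → Σ (NConf N) λ y → PathN N w n x y
  PathN-prefix zero m p = _ , done
  PathN-prefix (suc n) m (step e p) with PathN-prefix n m p
  ... | y , q = y , step e q

  data Forced : NConf N → NConf N → ℕ → Set where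
    forced-done : ∀ {x} → Forced x x 0
    forced-step : ∀ {x x' y n} → nextN N w x ≡ x' ∷ [] → Forced x' y n → Forced x y (suc n)

  Forced-++ : ∀ {x y z n m} → Forced x y n → Forced y z m → Forced x z (n + m)
  Forced-++ forced-done q = q
  Forced-++ (forced-step e p) q = forced-step e (Forced-++ p q)

  Forced⇒PathN : ∀ {x y n} → Forced x y n → PathN N w n x y
  Forced⇒PathN forced-done = done
  Forced⇒PathN (forced-step e p) = step (subst (_ ∈_) (sym e) (here refl)) (Forced⇒PathN p)

  Forced-resume : ∀ {x y n m z} → Forced x y n → PathN N w (n + m) x z → PathN N w m y z
  Forced-resume forced-done p = p
  Forced-resume (forced-step e d) (step mem p) with subst (_ ∈_) e mem
  ... | here refl = Forced-resume d p

  Forced-resume-halted : ∀ {x y n m z} → Forced x y n → PathN N w m x z → HaltedN N w z →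
    Σ ℕ λ k → PathN N w k y z
  Forced-resume-halted forced-done p h = _ , p
  Forced-resume-halted (forced-step e d) (step mem p) h with subst (_ ∈_) e mem
  ... | here refl = Forced-resume-halted d p h
  Forced-resume-halted (forced-step e d) done h with () ← trans (sym e) h

-- Deterministic machines as nondeterministic ones

∈-fromMaybe⁻ : ∀ {A : Set} {x : A} {m} → x ∈ fromMaybe m → m ≡ just x
∈-fromMaybe⁻ {m = just y} (here refl) = refl

-- The table of N is only required to agree pointwise with that of D, so that composite
-- machines whose table is not literally fromMaybe ∘ δ qualify as well.
module Deterministic (D : DTM)
  (δN : Fin (suc (DTM.q D)) → Maybe Bool → Vec (Sym (DTM.g D)) (DTM.k D) →
        List (Action (DTM.k D) (DTM.g D) (DTM.q D)))
  (δN-graph : ∀ s a h → δN s a h ≡ fromMaybe (DTM.δ D s a h)) where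

  N : NTM
  N = record { k = DTM.k D ; g = DTM.g D ; q = DTM.q D ; start = DTM.start D
             ; accepting = DTM.accepting D ; δ = δN }

  module _ (w : Word) where
    open Paths N w using (PathN-unsnoc)

    nextN≡stepD : ∀ c → nextN N w c ≡ fromMaybe (stepD D w c)
    nextN≡stepD c rewrite δN-graph (state c) (readIn w (inPos c)) (V.map head (tapes c))
      with DTM.δ D (state c) (readIn w (inPos c)) (V.map head (tapes c))
    ... | nothing = refl
    ... | just a = refl

    stepD⇒∈nextN : ∀ {x x'} → stepD D w x ≡ just x' → x' ∈ nextN N w x
    stepD⇒∈nextN {x} e rewrite nextN≡stepD x | e = here refl

    PathN⇒runD : ∀ {n x c} → PathN N w n x c → runD D w n x ≡ c
    PathN⇒runD done = refl
    PathN⇒runD (step {n} {x} {c₁} m p)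
      rewrite ∈-fromMaybe⁻ (subst (c₁ ∈_) (nextN≡stepD x) m) = PathN⇒runD p

    runD⇒PathN : ∀ n x → Σ ℕ λ m → PathN N w m x (runD D w n x)
    runD⇒PathN zero x = 0 , done
    runD⇒PathN (suc n) x with stepD D w x in e
    ... | nothing = 0 , done
    ... | just x' with runD⇒PathN n x'
    ...   | m , p = suc m , step (stepD⇒∈nextN e) p

    runD-step⇒PathN : ∀ n x y → stepD D w (runD D w n x) ≡ just y → PathN N w (suc n) x y
    runD-step⇒PathN zero x y e = step (stepD⇒∈nextN e) done
    runD-step⇒PathN (suc n) x y e with stepD D w x in e'
    ... | nothing with () ← trans (sym e') e
    ... | just x' = step (stepD⇒∈nextN e') (runD-step⇒PathN n x' y e)

    HaltedN⇒HaltedD : ∀ c → HaltedN N w c → HaltedD D w c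
    HaltedN⇒HaltedD c h with stepD D w c in e
    ... | nothing = refl
    ... | just y with () ← trans (sym h) (trans (nextN≡stepD c) (cong fromMaybe e))

    HaltedD⇒HaltedN : ∀ c → HaltedD D w c → HaltedN N w c
    HaltedD⇒HaltedN c h = trans (nextN≡stepD c) (cong fromMaybe h)

    AcceptsN⇔AcceptsD : AcceptsN N w ⇔ AcceptsD D w
    AcceptsN⇔AcceptsD = mk⇔ to from
      where
      to : AcceptsN N w → AcceptsD D w
      to (n , c , p , h , a) rewrite sym (PathN⇒runD p) = n , HaltedN⇒HaltedD _ h , a
      from : AcceptsD D w → AcceptsN N w
      from (n , h , a) with runD⇒PathN n (initD D)
      ... | m , p = m , runD D w n (initD D) , p , HaltedD⇒HaltedN _ h , a

    WithinD⇒WithinN : ∀ t → WithinD D w t → WithinN N w t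
    WithinD⇒WithinN t h c p with PathN-unsnoc p
    ... | c' , q , m rewrite sym (PathN⇒runD q) with () ← subst (c ∈_) (HaltedD⇒HaltedN _ h) m

    WithinN⇒WithinD : ∀ t → WithinN N w t → WithinD D w t
    WithinN⇒WithinD t h with stepD D w (runD D w t (initD D)) in e
    ... | nothing = refl
    ... | just y = ⊥-elim (h y (runD-step⇒PathN t (initD D) y e))

module AsNTM (D : DTM) = Deterministic D (λ s a h → fromMaybe (DTM.δ D s a h)) (λ _ _ _ → refl)

asNTM : DTM → NTM
asNTM = AsNTM.N

DTIME⊆NTIME : ∀ f L → DTIME f L → NTIME f L
DTIME⊆NTIME f L (D , accepts , c , within) =
  asNTM D , (λ w → ⇔.trans (accepts w) (⇔.sym (AcceptsN⇔AcceptsD w))) ,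
  c , λ w → WithinD⇒WithinN w _ (within w)
  where open AsNTM D

take-++ : ∀ {A : Set} {m n} (xs : Vec A m) (ys : Vec A n) → V.take m (xs ++ ys) ≡ xs
take-++ {m = m} xs ys = sym (++-injectiveˡ xs _ (proj₂ (proj₂ (V.splitAt m (xs ++ ys)))))

drop-++ : ∀ {A : Set} {m n} (xs : Vec A m) (ys : Vec A n) → V.drop m (xs ++ ys) ≡ ys
drop-++ {m = m} xs ys = sym (++-injectiveʳ xs _ (proj₂ (proj₂ (V.splitAt m (xs ++ ys)))))

replicate-+ : ∀ {A : Set} (x : A) m n → replicate (m + n) x ≡ replicate m x ++ replicate n x
replicate-+ x zero n = refl
replicate-+ x (suc m) n = cong (x ∷_) (replicate-+ x m n)

headOr : ∀ {A : Set} {n} → A → Vec A n → A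
headOr d [] = d
headOr d (x ∷ _) = x

mapTape : ∀ {g g'} → (Sym g → Sym g') → Tape g → Tape g'
mapTape f (tape l h r) = tape (L.map f l) (f h) (L.map f r)

stayAll : ∀ n → Vec Move n
stayAll n = replicate n Sm

rightFirst : ∀ n → Vec Move n
rightFirst zero = []
rightFirst (suc n) = Rm ∷ stayAll n

moveFirstRight : ∀ {g n} → Vec (Tape g) n → Vec (Tape g) n
moveFirstRight [] = []
moveFirstRight (t ∷ ts) = moveTape Rm t ∷ ts

updTapes-++ : ∀ {g m n} (ws : Vec (Sym g) m) (ms : Vec Move m) (ts : Vec (Tape g) m)
  (ws' : Vec (Sym g) n) (ms' : Vec Move n) (ts' : Vec (Tape g) n) →
  updTapes (ws ++ ws') (ms ++ ms') (ts ++ ts') ≡ updTapes ws ms ts ++ updTapes ws' ms' ts'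
updTapes-++ [] [] [] ws' ms' ts' = refl
updTapes-++ (w ∷ ws) (m ∷ ms) (t ∷ ts) ws' ms' ts' = cong (_ ∷_) (updTapes-++ ws ms ts ws' ms' ts')

updTapes-stay : ∀ {g n} (ts : Vec (Tape g) n) → updTapes (V.map head ts) (stayAll n) ts ≡ ts
updTapes-stay [] = refl
updTapes-stay (t ∷ ts) = cong (t ∷_) (updTapes-stay ts)

updTapes-rightFirst : ∀ {g n} (ts : Vec (Tape g) n) →
  updTapes (V.map head ts) (rightFirst n) ts ≡ moveFirstRight ts
updTapes-rightFirst [] = refl
updTapes-rightFirst (t ∷ ts) = cong (_ ∷_) (updTapes-stay ts)

moveTape-mapTape : ∀ {g g'} (f : Sym g → Sym g') → f blank ≡ blank →
  ∀ m t → moveTape m (mapTape f t) ≡ mapTape f (moveTape m t)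
moveTape-mapTape f f-blank Lm (tape [] h r) rewrite f-blank = refl
moveTape-mapTape f f-blank Lm (tape (x ∷ l) h r) = refl
moveTape-mapTape f f-blank Sm t = refl
moveTape-mapTape f f-blank Rm (tape l h []) rewrite f-blank = refl
moveTape-mapTape f f-blank Rm (tape l h (x ∷ r)) = refl

updTapes-mapTape : ∀ {g g' n} (f : Sym g → Sym g') → f blank ≡ blank →
  (ws : Vec (Sym g) n) (ms : Vec Move n) (ts : Vec (Tape g) n) →
  updTapes (V.map f ws) ms (V.map (mapTape f) ts) ≡ V.map (mapTape f) (updTapes ws ms ts)
updTapes-mapTape f f-blank [] [] [] = refl
updTapes-mapTape f f-blank (w ∷ ws) (m ∷ ms) (tape l h r ∷ ts) =
  cong₂ _∷_ (moveTape-mapTape f f-blank m (tape l w r)) (updTapes-mapTape f f-blank ws ms ts)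

bitOf : ∀ {g} → Sym g → Maybe Bool
bitOf (suc zero) = just false
bitOf (suc (suc zero)) = just true
bitOf _ = nothing

decode-[] : ∀ {g} (h : Sym g) r → decode (h ∷ r) ≡ [] → bitOf h ≡ nothing
decode-[] zero r e = refl
decode-[] (suc (suc (suc h))) r e = refl

decode-∷ : ∀ {g} (h : Sym g) r {b u} → decode (h ∷ r) ≡ b ∷ u → bitOf h ≡ just b × decode r ≡ u
decode-∷ (suc zero) r refl = refl , refl
decode-∷ (suc (suc zero)) r refl = refl , refl

decode-moveTape-Rm : ∀ {g} (l : List (Sym g)) h r →
  decode (head (moveTape Rm (tape l h r)) ∷ right (moveTape Rm (tape l h r))) ≡ decode r
decode-moveTape-Rm l h [] = refl
decode-moveTape-Rm l h (x ∷ r) = refl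

readIn-drop : ∀ (v : Word) j {b u} → drop j v ≡ b ∷ u → readIn v j ≡ just b
readIn-drop (x ∷ v) zero refl = refl
readIn-drop (x ∷ v) (suc j) e = readIn-drop v j e

drop-suc : ∀ (v : Word) j {b u} → drop j v ≡ b ∷ u → drop (suc j) v ≡ u
drop-suc (x ∷ v) zero refl = refl
drop-suc (x ∷ v) (suc j) e = drop-suc v j e

drop≡[]⇒length≤ : ∀ (v : Word) j → drop j v ≡ [] → length v ≤ j
drop≡[]⇒length≤ [] j e = z≤n
drop≡[]⇒length≤ (x ∷ v) (suc j) e = s≤s (drop≡[]⇒length≤ v j e)

readIn-beyond : ∀ (v : Word) j → length v ≤ j → readIn v j ≡ nothing
readIn-beyond [] j le = refl
readIn-beyond (x ∷ v) (suc j) (s≤s le) = readIn-beyond v j le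

isZero : ℕ → Bool
isZero zero = true
isZero (suc _) = false

-- The composite of a transducer and a machine

-- The composite machine has T's kT work tapes, then a tape X receiving T's output (later
-- read as M's input), then M's kM work tapes.  Its symbols are blank and the two bits
-- (shared by T and M), the marked versions 3, 4, 5 of blank, 0, 1 that flag cell 0 of X,
-- then T's extra symbols, then M's.
module Composite (T : DTM) (kM gM qM : ℕ) (startM : Fin (suc qM)) (accM : Fin (suc qM) → Bool) where
  open DTM T using () renaming (k to kT; g to gT; q to qT; start to startT; δ to δT)

  gC kC qC : ℕ
  gC = 3 + (gT + gM)
  kC = kT + suc kM
  qC = 2 + (suc qT + suc qM)

  SymC : Set
  SymC = Sym gC

  ActC : Set
  ActC = Action kC gC qC

  marked unmarked : Maybe Bool → SymC
  marked nothing = suc (suc (suc zero))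
  marked (just false) = suc (suc (suc (suc zero)))
  marked (just true) = suc (suc (suc (suc (suc zero))))
  unmarked nothing = zero
  unmarked (just false) = suc zero
  unmarked (just true) = suc (suc zero)

  cellSym : Bool → Maybe Bool → SymC
  cellSym true = marked
  cellSym false = unmarked

  readCell : SymC → Maybe Bool
  readCell (suc zero) = just false
  readCell (suc (suc zero)) = just true
  readCell (suc (suc (suc (suc zero)))) = just false
  readCell (suc (suc (suc (suc (suc zero))))) = just true
  readCell _ = nothing

  isMarked : SymC → Bool
  isMarked (suc (suc (suc zero))) = true
  isMarked (suc (suc (suc (suc zero)))) = true
  isMarked (suc (suc (suc (suc (suc zero))))) = true
  isMarked _ = false

  embT : Sym gT → SymC
  embT zero = zero
  embT (suc zero) = suc zero
  embT (suc (suc zero)) = suc (suc zero)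
  embT (suc (suc (suc y))) = suc (suc (suc (suc (suc (suc (y ↑ˡ gM))))))

  projT : SymC → Sym gT
  projT zero = zero
  projT (suc zero) = suc zero
  projT (suc (suc zero)) = suc (suc zero)
  projT (suc (suc (suc (suc (suc (suc z)))))) = [ (λ y → suc (suc (suc y))) , (λ _ → zero) ]′ (splitAt gT z)
  projT _ = zero

  embM : Sym gM → SymC
  embM zero = zero
  embM (suc zero) = suc zero
  embM (suc (suc zero)) = suc (suc zero)
  embM (suc (suc (suc y))) = suc (suc (suc (suc (suc (suc (gT ↑ʳ y))))))

  projM : SymC → Sym gM
  projM zero = zero
  projM (suc zero) = suc zero
  projM (suc (suc zero)) = suc (suc zero)
  projM (suc (suc (suc (suc (suc (suc z)))))) = [ (λ _ → zero) , (λ y → suc (suc (suc y))) ]′ (splitAt gT z)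
  projM _ = zero

  projT-embT : ∀ x → projT (embT x) ≡ x
  projT-embT zero = refl
  projT-embT (suc zero) = refl
  projT-embT (suc (suc zero)) = refl
  projT-embT (suc (suc (suc y))) rewrite splitAt-↑ˡ gT y gM = refl

  projM-embM : ∀ x → projM (embM x) ≡ x
  projM-embM zero = refl
  projM-embM (suc zero) = refl
  projM-embM (suc (suc zero)) = refl
  projM-embM (suc (suc (suc y))) rewrite splitAt-↑ʳ gT gM y = refl

  bitOf-embT : ∀ x → bitOf (embT x) ≡ bitOf x
  bitOf-embT zero = refl
  bitOf-embT (suc zero) = refl
  bitOf-embT (suc (suc zero)) = refl
  bitOf-embT (suc (suc (suc x))) = refl

  -- copy b: copying T's output to X, where b says whether the head of X is on cell 0.
  data Phase : Set where
    transduce : Fin (suc qT) → Phase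
    copy      : Bool → Phase
    rewind    : Phase
    simulate  : Fin (suc qM) → Phase

  encPhase : Phase → Fin (suc qC)
  encPhase (copy true) = zero
  encPhase (copy false) = suc zero
  encPhase rewind = suc (suc zero)
  encPhase (transduce s) = suc (suc (suc (s ↑ˡ suc qM)))
  encPhase (simulate s) = suc (suc (suc (suc qT ↑ʳ s)))

  decPhase : Fin (suc qC) → Phase
  decPhase zero = copy true
  decPhase (suc zero) = copy false
  decPhase (suc (suc zero)) = rewind
  decPhase (suc (suc (suc x))) = [ transduce , simulate ]′ (splitAt (suc qT) x)

  decPhase-encPhase : ∀ p → decPhase (encPhase p) ≡ p
  decPhase-encPhase (copy true) = refl
  decPhase-encPhase (copy false) = refl
  decPhase-encPhase rewind = refl
  decPhase-encPhase (transduce s) rewrite splitAt-↑ˡ (suc qT) s (suc qM) = refl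
  decPhase-encPhase (simulate s) rewrite splitAt-↑ʳ (suc qT) (suc qM) s = refl

  stayC : Vec Move kC
  stayC = stayAll kT ++ (Sm ∷ stayAll kM)

  transduceStep : Maybe (Action kT gT qT) → Vec SymC kT → SymC → Vec SymC kM → ActC
  transduceStep nothing hT hX hM = encPhase (copy true) , hT ++ (hX ∷ hM) , Sm , stayC
  transduceStep (just (s , ws , m , ms)) hT hX hM =
    encPhase (transduce s) , V.map embT ws ++ (hX ∷ hM) , m , ms ++ (Sm ∷ stayAll kM)

  copyStep : Bool → Maybe Bool → Vec SymC kT → Vec SymC kM → ActC
  copyStep first (just b) hT hM =
    encPhase (copy false) , hT ++ (cellSym first (just b) ∷ hM) , Sm , rightFirst kT ++ (Rm ∷ stayAll kM)
  copyStep first nothing hT hM = encPhase rewind , hT ++ (cellSym first nothing ∷ hM) , Sm , stayC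

  rewindStep : Bool → Vec SymC kT → SymC → Vec SymC kM → ActC
  rewindStep true hT hX hM = encPhase (simulate startM) , hT ++ (hX ∷ hM) , Sm , stayC
  rewindStep false hT hX hM = encPhase rewind , hT ++ (hX ∷ hM) , Sm , stayAll kT ++ (Lm ∷ stayAll kM)

  -- M's input head cannot leave cell 0 to the left, which on X is the marked cell.
  inputMove : Move → Bool → Move
  inputMove Lm true = Sm
  inputMove Lm false = Lm
  inputMove Sm _ = Sm
  inputMove Rm _ = Rm

  simulateStep : Vec SymC kT → SymC → Vec SymC kM → Action kM gM qM → ActC
  simulateStep hT hX hM (s , ws , m , ms) =
    encPhase (simulate s) , hT ++ (hX ∷ V.map embM ws) , Sm , stayAll kT ++ (inputMove m (isMarked hX) ∷ ms)

  NTable DTable : Set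
  NTable = Fin (suc qM) → Maybe Bool → Vec (Sym gM) kM → List (Action kM gM qM)
  DTable = Fin (suc qM) → Maybe Bool → Vec (Sym gM) kM → Maybe (Action kM gM qM)

  δN : NTable → Phase → Maybe Bool → Vec SymC kT → Vec SymC (suc kM) → List ActC
  δN δM (transduce s) a hT (hX ∷ hM) = [ transduceStep (δT s a (V.map projT hT)) hT hX hM ]
  δN δM (copy first) a hT (hX ∷ hM) = [ copyStep first (bitOf (headOr blank hT)) hT hM ]
  δN δM rewind a hT (hX ∷ hM) = [ rewindStep (isMarked hX) hT hX hM ]
  δN δM (simulate s) a hT (hX ∷ hM) = L.map (simulateStep hT hX hM) (δM s (readCell hX) (V.map projM hM))

  δD : DTable → Phase → Maybe Bool → Vec SymC kT → Vec SymC (suc kM) → Maybe ActC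
  δD δM (transduce s) a hT (hX ∷ hM) = just (transduceStep (δT s a (V.map projT hT)) hT hX hM)
  δD δM (copy first) a hT (hX ∷ hM) = just (copyStep first (bitOf (headOr blank hT)) hT hM)
  δD δM rewind a hT (hX ∷ hM) = just (rewindStep (isMarked hX) hT hX hM)
  δD δM (simulate s) a hT (hX ∷ hM) = Maybe.map (simulateStep hT hX hM) (δM s (readCell hX) (V.map projM hM))

  acceptingC : Fin (suc qC) → Bool
  acceptingC s with decPhase s
  ... | simulate s' = accM s'
  ... | _ = false

  compositeN : NTable → NTM
  compositeN δM = record { k = kC ; g = gC ; q = qC ; start = encPhase (transduce startT) ; accepting = acceptingC
                         ; δ = λ s a hs → δN δM (decPhase s) a (V.take kT hs) (V.drop kT hs) }

  compositeD : DTable → DTM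
  compositeD δM = record { k = kC ; g = gC ; q = qC ; start = encPhase (transduce startT) ; accepting = acceptingC
                         ; δ = λ s a hs → δD δM (decPhase s) a (V.take kT hs) (V.drop kT hs) }

  compositeN-graph : ∀ (δM : DTable) s a hs →
    NTM.δ (compositeN (λ s a h → fromMaybe (δM s a h))) s a hs ≡ fromMaybe (DTM.δ (compositeD δM) s a hs)
  compositeN-graph δM s a hs with decPhase s | V.drop kT hs
  ... | simulate s' | hX ∷ hM with δM s' (readCell hX) (V.map projM hM)
  ...   | nothing = refl
  ...   | just _ = refl
  compositeN-graph δM s a hs | transduce _ | _ ∷ _ = refl
  compositeN-graph δM s a hs | copy _ | _ ∷ _ = refl
  compositeN-graph δM s a hs | rewind | _ ∷ _ = refl

-- Correctness of the composite

module CompositeCorrect (T : DTM) (M : NTM) where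
  open DTM T using () renaming (k to kT; g to gT; q to qT; start to startT; δ to δT)
  open NTM M using () renaming (k to kM; g to gM; q to qM; start to startM; accepting to accM; δ to δM)
  open Composite T kM gM qM startM accM

  C : NTM
  C = compositeN δM

  blankM : Vec (Tape gC) kM
  blankM = replicate kM emptyTape

  blankXM : Vec (Tape gC) (suc kM)
  blankXM = emptyTape ∷ blankM

  projT-heads : ∀ {n} (ts : Vec (Tape gT) n) → V.map projT (V.map head (V.map (mapTape embT) ts)) ≡ V.map head ts
  projT-heads [] = refl
  projT-heads (tape l h r ∷ ts) = cong₂ _∷_ (projT-embT h) (projT-heads ts)

  projM-heads : ∀ {n} (ts : Vec (Tape gM) n) → V.map projM (V.map head (V.map (mapTape embM) ts)) ≡ V.map head ts
  projM-heads [] = refl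
  projM-heads (tape l h r ∷ ts) = cong₂ _∷_ (projM-embM h) (projM-heads ts)

  moveFirstRight-mapTape : ∀ {n} (ts : Vec (Tape gT) n) →
    moveFirstRight (V.map (mapTape embT) ts) ≡ V.map (mapTape embT) (moveFirstRight ts)
  moveFirstRight-mapTape [] = refl
  moveFirstRight-mapTape (t ∷ ts) = cong (_∷ _) (moveTape-mapTape embT refl Rm t)

  outputTapes≡[] : ∀ {n} (ts : Vec (Tape gT) n) → outputTapes ts ≡ [] →
    bitOf (headOr blank (V.map head (V.map (mapTape embT) ts))) ≡ nothing
  outputTapes≡[] [] e = refl
  outputTapes≡[] (tape l h r ∷ ts) e = trans (bitOf-embT h) (decode-[] h r e)

  outputTapes≡∷ : ∀ {n} (ts : Vec (Tape gT) n) {b u} → outputTapes ts ≡ b ∷ u →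
    bitOf (headOr blank (V.map head (V.map (mapTape embT) ts))) ≡ just b × outputTapes (moveFirstRight ts) ≡ u
  outputTapes≡∷ (tape l h r ∷ ts) e with decode-∷ h r e
  ... | e₁ , e₂ = trans (bitOf-embT h) e₁ , trans (decode-moveTape-Rm l h r) e₂

  applyAction-++ : ∀ s i (ts : Vec (Tape gC) kT) t us s' (wT : Vec SymC kT) x wM m mT mx mM →
    applyAction {kC} {gC} {qC} (config s i (ts ++ (t ∷ us))) (s' , wT ++ (x ∷ wM) , m , mT ++ (mx ∷ mM))
    ≡ config s' (moveIn m i) (updTapes wT mT ts ++ (moveTape mx (writeTape x t) ∷ updTapes wM mM us))
  applyAction-++ s i ts t us s' wT x wM m mT mx mM =
    cong (config s' (moveIn m i)) (updTapes-++ wT mT ts (x ∷ wM) (mx ∷ mM) (t ∷ us))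

  stepD≡just : ∀ w x x' → stepD T w x ≡ just x' →
    Σ _ λ a → δT (state x) (readIn w (inPos x)) (V.map head (tapes x)) ≡ just a × applyAction x a ≡ x'
  stepD≡just w x x' e with δT (state x) (readIn w (inPos x)) (V.map head (tapes x))
  ... | just a = a , refl , just-injective e

  stepD≡nothing : ∀ w x → stepD T w x ≡ nothing → δT (state x) (readIn w (inPos x)) (V.map head (tapes x)) ≡ nothing
  stepD≡nothing w x e with δT (state x) (readIn w (inPos x)) (V.map head (tapes x))
  ... | nothing = refl

  module _ (w : Word) where
    open Paths C w

    nextN-C : ∀ p i (ts : Vec (Tape gC) kT) t (us : Vec (Tape gC) kM) →
      nextN C w (config (encPhase p) i (ts ++ (t ∷ us))) ≡
      L.map (applyAction (config (encPhase p) i (ts ++ (t ∷ us))))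
            (δN δM p (readIn w i) (V.map head ts) (head t ∷ V.map head us))
    nextN-C p i ts t us rewrite map-++ head ts (t ∷ us) | take-++ (V.map head ts) (head t ∷ V.map head us)
      | drop-++ (V.map head ts) (head t ∷ V.map head us) | decPhase-encPhase p = refl

    inTransduce : DConf T → NConf C
    inTransduce x = config (encPhase (transduce (state x))) (inPos x) (V.map (mapTape embT) (tapes x) ++ blankXM)

    nextN-inTransduce : ∀ x x' → stepD T w x ≡ just x' → nextN C w (inTransduce x) ≡ inTransduce x' ∷ []
    nextN-inTransduce x x' e with stepD≡just w x x' e
    ... | (s' , ws , m , ms) , e₁ , refl
      rewrite nextN-C (transduce (state x)) (inPos x) (V.map (mapTape embT) (tapes x)) emptyTape blankM
            | projT-heads (tapes x) | e₁ =
      cong (_∷ []) (trans (applyAction-++ (encPhase (transduce (state x))) (inPos x) _ _ _ _ _ _ _ m _ _ _)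
        (cong (config (encPhase (transduce s')) (moveIn m (inPos x)))
          (cong₂ _++_ (updTapes-mapTape embT refl ws ms (tapes x)) (cong (emptyTape ∷_) (updTapes-stay blankM)))))

    transduce-Forced : ∀ n x → Σ ℕ λ k → k ≤ n × Forced (inTransduce x) (inTransduce (runD T w n x)) k
    transduce-Forced zero x = 0 , z≤n , forced-done
    transduce-Forced (suc n) x with stepD T w x in e
    ... | nothing = 0 , z≤n , forced-done
    ... | just x' with transduce-Forced n x'
    ...   | k , k≤n , d = suc k , s≤s k≤n , forced-step (nextN-inTransduce x x' e) d

    nextN-inTransduce-halted : ∀ y → stepD T w y ≡ nothing →
      nextN C w (inTransduce y) ≡ config (encPhase (copy true)) (inPos y) (V.map (mapTape embT) (tapes y) ++ blankXM) ∷ []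
    nextN-inTransduce-halted y e
      rewrite nextN-C (transduce (state y)) (inPos y) (V.map (mapTape embT) (tapes y)) emptyTape blankM
            | projT-heads (tapes y) | stepD≡nothing w y e =
      cong (_∷ []) (trans (applyAction-++ (encPhase (transduce (state y))) (inPos y) _ _ _ _ _ _ _ Sm _ _ _)
        (cong (config (encPhase (copy true)) (inPos y))
          (cong₂ _++_ (updTapes-stay _) (cong (emptyTape ∷_) (updTapes-stay blankM)))))

    module InputCopy (v : Word) where
      cell : ℕ → SymC
      cell j = cellSym (isZero j) (readIn v j)

      cellsBefore : ℕ → List SymC
      cellsBefore zero = []
      cellsBefore (suc j) = cell j ∷ cellsBefore j

      CellsFrom : ℕ → List SymC → Set
      CellsFrom j [] = length v ≤ j
      CellsFrom j (x ∷ xs) = x ≡ cell j × CellsFrom (suc j) xs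

      CopyAt : ℕ → Tape gC → Set
      CopyAt p t = left t ≡ cellsBefore p × head t ≡ cell p × CellsFrom (suc p) (right t)

      isMarked-marked : ∀ m → isMarked (marked m) ≡ true
      isMarked-marked nothing = refl
      isMarked-marked (just false) = refl
      isMarked-marked (just true) = refl

      isMarked-unmarked : ∀ m → isMarked (unmarked m) ≡ false
      isMarked-unmarked nothing = refl
      isMarked-unmarked (just false) = refl
      isMarked-unmarked (just true) = refl

      readCell-cellSym : ∀ b m → readCell (cellSym b m) ≡ m
      readCell-cellSym true nothing = refl
      readCell-cellSym true (just false) = refl
      readCell-cellSym true (just true) = refl
      readCell-cellSym false nothing = refl
      readCell-cellSym false (just false) = refl
      readCell-cellSym false (just true) = refl

      CopyAt-Lm : ∀ p t → CopyAt (suc p) t → CopyAt p (moveTape Lm t)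
      CopyAt-Lm p (tape .(cell p ∷ cellsBefore p) h r) (refl , eh , er) = refl , refl , eh , er

      CopyAt-inputMove : ∀ m p t → CopyAt p t → CopyAt (moveIn m p) (moveTape (inputMove m (isMarked (head t))) t)
      CopyAt-inputMove Sm p t c = c
      CopyAt-inputMove Rm p (tape l h []) (refl , refl , er) =
        refl , cong unmarked (sym (readIn-beyond v (suc p) er)) , m≤n⇒m≤1+n er
      CopyAt-inputMove Rm p (tape l h (x ∷ r)) (refl , refl , er) = refl , er
      CopyAt-inputMove Lm zero (tape l h r) (el , refl , er) rewrite isMarked-marked (readIn v 0) = el , refl , er
      CopyAt-inputMove Lm (suc p) (tape l h r) (el , refl , er) rewrite isMarked-unmarked (readIn v (suc p)) =
        CopyAt-Lm p (tape l _ r) (el , refl , er)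

      module _ (i : ℕ) where
        copying : ℕ → Vec (Tape gT) kT → NConf C
        copying j ts = config (encPhase (copy (isZero j))) i
                         (V.map (mapTape embT) ts ++ (tape (cellsBefore j) blank [] ∷ blankM))

        rewinding : Vec (Tape gC) kT → Tape gC → NConf C
        rewinding ts t = config (encPhase rewind) i (ts ++ (t ∷ blankM))

        simulating : Vec (Tape gC) kT → Tape gC → NConf C
        simulating ts t = config (encPhase (simulate startM)) i (ts ++ (t ∷ blankM))

        copy-Forced : ∀ u j ts → drop j v ≡ u → outputTapes ts ≡ u →
          Σ (Vec (Tape gC) kT) λ ts' → Σ (Tape gC) λ t →
            CopyAt (j + length u) t × Forced (copying j ts) (rewinding ts' t) (suc (length u))
        copy-Forced [] j ts dv out =
          V.map (mapTape embT) ts , tX ,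
          subst (λ z → CopyAt z tX) (sym (+-identityʳ j))
            (refl , cong (cellSym (isZero j)) (sym (readIn-beyond v j |v|≤j)) , m≤n⇒m≤1+n |v|≤j) ,
          forced-step next forced-done
          where
          |v|≤j = drop≡[]⇒length≤ v j dv
          tX = tape (cellsBefore j) (cellSym (isZero j) nothing) []
          next : nextN C w (copying j ts) ≡ rewinding (V.map (mapTape embT) ts) tX ∷ []
          next rewrite nextN-C (copy (isZero j)) i (V.map (mapTape embT) ts) (tape (cellsBefore j) blank []) blankM
                     | outputTapes≡[] ts out =
            cong (_∷ []) (trans (applyAction-++ (encPhase (copy (isZero j))) i _ _ _ _ _ _ _ Sm _ _ _)
              (cong (config (encPhase rewind) i)
                (cong₂ _++_ (updTapes-stay _) (cong (tX ∷_) (updTapes-stay blankM)))))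
        copy-Forced (b ∷ u) j ts dv out
          with copy-Forced u (suc j) (moveFirstRight ts) (drop-suc v j dv) (proj₂ (outputTapes≡∷ ts out))
        ... | ts' , t , c , d = ts' , t , subst (λ z → CopyAt z t) (sym (+-suc j (length u))) c , forced-step next d
          where
          next : nextN C w (copying j ts) ≡ copying (suc j) (moveFirstRight ts) ∷ []
          next rewrite nextN-C (copy (isZero j)) i (V.map (mapTape embT) ts) (tape (cellsBefore j) blank []) blankM
                     | proj₁ (outputTapes≡∷ ts out) =
            cong (_∷ []) (trans (applyAction-++ (encPhase (copy (isZero j))) i _ _ _ _ _ _ _ Sm _ _ _)
              (cong (config (encPhase (copy false)) i)
                (cong₂ _++_ (trans (updTapes-rightFirst _) (moveFirstRight-mapTape ts))
                  (cong₂ _∷_ (cong (λ z → tape (cellSym (isZero j) z ∷ cellsBefore j) blank []) (sym (readIn-drop v j dv)))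
                             (updTapes-stay blankM)))))

        rewind-Forced : ∀ p ts t → CopyAt p t →
          Σ (Tape gC) λ t₀ → CopyAt 0 t₀ × Forced (rewinding ts t) (simulating ts t₀) (suc p)
        rewind-Forced zero ts (tape l h r) c@(_ , refl , _) = tape l h r , c , forced-step next forced-done
          where
          next : nextN C w (rewinding ts (tape l h r)) ≡ simulating ts (tape l h r) ∷ []
          next rewrite nextN-C rewind i ts (tape l h r) blankM | isMarked-marked (readIn v 0) =
            cong (_∷ []) (trans (applyAction-++ (encPhase rewind) i _ _ _ _ _ _ _ Sm _ _ _)
              (cong (config (encPhase (simulate startM)) i)
                (cong₂ _++_ (updTapes-stay _) (cong (tape l (cell 0) r ∷_) (updTapes-stay blankM)))))
        rewind-Forced (suc p) ts (tape l h r) c@(_ , refl , _)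
          with rewind-Forced p ts (moveTape Lm (tape l h r)) (CopyAt-Lm p _ c)
        ... | t₀ , c₀ , d = t₀ , c₀ , forced-step next d
          where
          next : nextN C w (rewinding ts (tape l h r)) ≡ rewinding ts (moveTape Lm (tape l h r)) ∷ []
          next rewrite nextN-C rewind i ts (tape l h r) blankM | isMarked-unmarked (readIn v (suc p)) =
            cong (_∷ []) (trans (applyAction-++ (encPhase rewind) i _ _ _ _ _ _ _ Sm _ _ _)
              (cong (config (encPhase rewind) i)
                (cong₂ _++_ (updTapes-stay _)
                  (cong (moveTape Lm (tape l (cell (suc p)) r) ∷_) (updTapes-stay blankM)))))

      Simulates : NConf C → NConf M → Set
      Simulates c d = Σ ℕ λ i → Σ (Vec (Tape gC) kT) λ ts → Σ (Tape gC) λ t →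
        c ≡ config (encPhase (simulate (state d))) i (ts ++ (t ∷ V.map (mapTape embM) (tapes d))) ×
        CopyAt (inPos d) t

      nextN-Simulates : ∀ c d → Simulates c d →
        Σ (List (Action kM gM qM)) λ as → Σ (Action kM gM qM → NConf C) λ F →
          nextN C w c ≡ L.map F as × nextN M v d ≡ L.map (applyAction d) as ×
          (∀ a → Simulates (F a) (applyAction d a))
      nextN-Simulates ._ d (i , ts , tape l h r , refl , c@(_ , refl , _)) =
        NTM.δ M (state d) (readIn v (inPos d)) (V.map head (tapes d)) , F , nextC , refl , simulates
        where
        c₀ = config (encPhase (simulate (state d))) i (ts ++ (tape l h r ∷ V.map (mapTape embM) (tapes d)))
        F : Action kM gM qM → NConf C
        F = applyAction c₀ ∘ simulateStep (V.map head ts) h (V.map head (V.map (mapTape embM) (tapes d)))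
        nextC : nextN C w c₀ ≡ L.map F (NTM.δ M (state d) (readIn v (inPos d)) (V.map head (tapes d)))
        nextC rewrite nextN-C (simulate (state d)) i ts (tape l h r) (V.map (mapTape embM) (tapes d))
                    | projM-heads (tapes d) | readCell-cellSym (isZero (inPos d)) (readIn v (inPos d)) = sym (map-∘ _)
        simulates : ∀ a → Simulates (F a) (applyAction d a)
        simulates (s' , ws , m , ms) = i , ts , moveTape (inputMove m (isMarked h)) (tape l h r) ,
          trans (applyAction-++ (encPhase (simulate (state d))) i ts (tape l h r) _ _ _ _ _ Sm _ _ _)
            (cong (config (encPhase (simulate s')) i)
              (cong₂ _++_ (updTapes-stay ts)
                (cong (moveTape (inputMove m (isMarked h)) (tape l h r) ∷_) (updTapes-mapTape embM refl ws ms (tapes d))))) ,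
          CopyAt-inputMove m (inPos d) (tape l h r) c

      PathN-project : ∀ {n c c' d} → Simulates c d → PathN C w n c c' →
        Σ (NConf M) λ d' → PathN M v n d d' × Simulates c' d'
      PathN-project {d = d} s done = d , done , s
      PathN-project {c = c} {d = d} s (step mem p) with nextN-Simulates c d s
      ... | as , F , eC , eM , sim with ∈-map⁻ F (subst (_ ∈_) eC mem)
      ... | a , a∈ , refl with PathN-project (sim a) p
      ... | d' , q , s' = d' , step (subst (_ ∈_) (sym eM) (∈-map⁺ (applyAction d) a∈)) q , s'

      PathN-lift : ∀ {n c d d'} → Simulates c d → PathN M v n d d' →
        Σ (NConf C) λ c' → PathN C w n c c' × Simulates c' d'
      PathN-lift {c = c} s done = c , done , s
      PathN-lift {c = c} {d = d} s (step mem p) with nextN-Simulates c d s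
      ... | as , F , eC , eM , sim with ∈-map⁻ (applyAction d) (subst (_ ∈_) eM mem)
      ... | a , a∈ , refl with PathN-lift (sim a) p
      ... | c' , q , s' = c' , step (subst (_ ∈_) (sym eC) (∈-map⁺ F a∈)) q , s'

      HaltedN-project : ∀ {c d} → Simulates c d → HaltedN C w c → HaltedN M v d
      HaltedN-project {c} {d} s h with nextN-Simulates c d s
      ... | [] , F , eC , eM , sim = eM
      ... | _ ∷ _ , F , eC , eM , sim with () ← trans (sym eC) h

      HaltedN-lift : ∀ {c d} → Simulates c d → HaltedN M v d → HaltedN C w c
      HaltedN-lift {c} {d} s h with nextN-Simulates c d s
      ... | [] , F , eC , eM , sim = eC
      ... | _ ∷ _ , F , eC , eM , sim with () ← trans (sym eM) h

      accepting-Simulates : ∀ {c d} → Simulates c d → NTM.accepting C (state c) ≡ accM (state d)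
      accepting-Simulates {d = d} (i , ts , t , refl , _) rewrite decPhase-encPhase (simulate (state d)) = refl

    module AfterTransduction (t : ℕ) (halts : WithinD T w t) where
      y : DConf T
      y = runD T w t (initD T)

      v : Word
      v = outputTapes (tapes y)

      open InputCopy v

      preludeBound : ℕ
      preludeBound = t + suc (suc (length v) + suc (length v))

      initN-C : initN C ≡ inTransduce (initD T)
      initN-C = cong (config (encPhase (transduce startT)) 0)
        (trans (replicate-+ emptyTape kT (suc kM))
               (cong (_++ blankXM) (sym (map-replicate (mapTape embT) emptyTape kT))))

      prelude : Σ (NConf C) λ c → Σ ℕ λ k → k ≤ preludeBound × Forced (initN C) c k × Simulates c (initN M)
      prelude with transduce-Forced t (initD T) | copy-Forced (inPos y) v 0 (tapes y) refl refl
      ... | k , k≤t , transduced | ts , tX , copyAt , copied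
        with rewind-Forced (inPos y) (length v) ts tX copyAt
      ... | t₀ , copyAt₀ , rewound =
        simulating (inPos y) ts t₀ , k + suc (suc (length v) + suc (length v)) , +-monoˡ-≤ _ k≤t ,
        subst (λ c → Forced c (simulating (inPos y) ts t₀) (k + suc (suc (length v) + suc (length v)))) (sym initN-C)
          (Forced-++ transduced (forced-step (nextN-inTransduce-halted y halts) (Forced-++ copied rewound))) ,
        inPos y , ts , t₀ ,
        cong (λ us → config (encPhase (simulate startM)) (inPos y) (ts ++ (t₀ ∷ us))) (sym (map-replicate (mapTape embM) emptyTape kM)) ,
        copyAt₀

      AcceptsN-C⇔ : AcceptsN C w ⇔ AcceptsN M v
      AcceptsN-C⇔ with prelude
      ... | c₀ , k , _ , forced , s₀ = mk⇔ to from
        where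
        to : AcceptsN C w → AcceptsN M v
        to (n , c , p , h , a) with Forced-resume-halted forced p h
        ... | m , q with PathN-project s₀ q
        ... | d , q' , s = m , d , q' , HaltedN-project s h , trans (sym (accepting-Simulates s)) a
        from : AcceptsN M v → AcceptsN C w
        from (n , d , p , h , a) with PathN-lift s₀ p
        ... | c , q , s = k + n , c , PathN-++ (Forced⇒PathN forced) q , HaltedN-lift s h , trans (accepting-Simulates s) a

      WithinN-C : ∀ tM B → WithinN M v tM → preludeBound + tM ≤ B → WithinN C w B
      WithinN-C tM B withinM bound c p with prelude
      ... | c₀ , k , k≤ , forced , s₀
        with m≤n⇒∃[o]m+o≡n (≤-trans (+-monoˡ-≤ (suc tM) k≤) (≤-trans (≤-reflexive (+-suc preludeBound tM)) (s≤s bound)))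
      ... | e , k+tM+e≡B with PathN-prefix (k + suc tM) e (subst (λ n → PathN C w n (initN C) c) (sym k+tM+e≡B) p)
      ... | c' , p' with PathN-project s₀ (Forced-resume forced p')
      ... | d , q , _ = withinM d q

-- Running time of the composite

firstRightLength : ∀ {g k} → Vec (Tape g) k → ℕ
firstRightLength [] = 0
firstRightLength (t ∷ _) = length (right t)

firstRightLength-updTapes : ∀ {g k} (ws : Vec (Sym g) k) ms ts →
  firstRightLength (updTapes ws ms ts) ≤ suc (firstRightLength ts)
firstRightLength-updTapes [] [] [] = z≤n
firstRightLength-updTapes (a ∷ ws) (Lm ∷ ms) (tape [] h r ∷ ts) = ≤-refl
firstRightLength-updTapes (a ∷ ws) (Lm ∷ ms) (tape (x ∷ l) h r ∷ ts) = ≤-refl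
firstRightLength-updTapes (a ∷ ws) (Sm ∷ ms) (tape l h r ∷ ts) = n≤1+n _
firstRightLength-updTapes (a ∷ ws) (Rm ∷ ms) (tape l h [] ∷ ts) = z≤n
firstRightLength-updTapes (a ∷ ws) (Rm ∷ ms) (tape l h (x ∷ r) ∷ ts) = m≤n⇒m≤1+n (n≤1+n _)

firstRightLength-blank : ∀ {g} k → firstRightLength {g} {k} (replicate k emptyTape) ≡ 0
firstRightLength-blank zero = refl
firstRightLength-blank (suc k) = refl

length-decode : ∀ {g} (xs : List (Sym g)) → length (decode xs) ≤ length xs
length-decode [] = z≤n
length-decode (zero ∷ xs) = z≤n
length-decode (suc zero ∷ xs) = s≤s (length-decode xs)
length-decode (suc (suc zero) ∷ xs) = s≤s (length-decode xs)
length-decode (suc (suc (suc _)) ∷ xs) = z≤n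

length-outputTapes : ∀ {g k} (ts : Vec (Tape g) k) → length (outputTapes ts) ≤ suc (firstRightLength ts)
length-outputTapes [] = z≤n
length-outputTapes (tape l h r ∷ ts) = length-decode (h ∷ r)

module _ (T : DTM) (w : Word) where
  firstRightLength-stepD : ∀ x x' → stepD T w x ≡ just x' →
    firstRightLength (tapes x') ≤ suc (firstRightLength (tapes x))
  firstRightLength-stepD x x' e with DTM.δ T (state x) (readIn w (inPos x)) (V.map head (tapes x))
  firstRightLength-stepD x x' refl | just (s , ws , m , ms) = firstRightLength-updTapes ws ms (tapes x)

  firstRightLength-runD : ∀ n x → firstRightLength (tapes (runD T w n x)) ≤ firstRightLength (tapes x) + n
  firstRightLength-runD zero x = ≤-reflexive (sym (+-identityʳ _))
  firstRightLength-runD (suc n) x with stepD T w x in e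
  ... | nothing = m≤m+n _ _
  ... | just x' = begin
    firstRightLength (tapes (runD T w n x')) ≤⟨ firstRightLength-runD n x' ⟩
    firstRightLength (tapes x') + n          ≤⟨ +-monoˡ-≤ n (firstRightLength-stepD x x' e) ⟩
    suc (firstRightLength (tapes x)) + n     ≡⟨ sym (+-suc _ n) ⟩
    firstRightLength (tapes x) + suc n       ∎
    where open ≤-Reasoning

  length-outputD : ∀ t → length (outputD T w t) ≤ suc t
  length-outputD t = ≤-trans (length-outputTapes (tapes (runD T w t (initD T))))
    (s≤s (≤-trans (firstRightLength-runD t (initD T))
                  (≤-reflexive (cong (_+ t) (firstRightLength-blank (DTM.k T))))))

TimeBound-mono : ∀ {f} → TimeBound f → ∀ {m n} → m ≤ n → f m ≤ f n
TimeBound-mono {f} (_ , f-step) {m} m≤n = go (≤⇒≤′ m≤n)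
  where
  go : ∀ {n} → m ≤′ n → f m ≤ f n
  go ≤′-refl = ≤-refl
  go (≤′-step p) = ≤-trans (go p) (f-step _)

subhomogeneous-affine : ∀ {f} → TimeBound f → Subhomogeneous f → ∀ a →
  Σ ℕ λ b → ∀ n u → u ≤ a * n + a → f u ≤ b * f n + b
subhomogeneous-affine {f} tb sh a with sh (suc (a + a)) (s≤s z≤n)
... | c̄ , _ , scale = c̄ + f a , bound
  where
  bound : ∀ n u → u ≤ a * n + a → f u ≤ (c̄ + f a) * f n + (c̄ + f a)
  bound zero u u≤ = begin
    f u                          ≤⟨ TimeBound-mono tb (≤-trans u≤ (≤-reflexive (cong (_+ a) (*-zeroʳ a)))) ⟩
    f a                          ≤⟨ m≤n+m (f a) c̄ ⟩
    c̄ + f a                      ≤⟨ m≤n+m _ ((c̄ + f a) * f 0) ⟩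
    (c̄ + f a) * f 0 + (c̄ + f a)  ∎
    where open ≤-Reasoning
  bound (suc n) u u≤ = begin
    f u                                  ≤⟨ TimeBound-mono tb u≤scaled ⟩
    f (suc (a + a) * suc n)              ≤⟨ scale (suc n) (s≤s z≤n) ⟩
    c̄ * f (suc n)                        ≤⟨ *-monoˡ-≤ (f (suc n)) (m≤m+n c̄ (f a)) ⟩
    (c̄ + f a) * f (suc n)                ≤⟨ m≤m+n _ _ ⟩
    (c̄ + f a) * f (suc n) + (c̄ + f a)    ∎
    where
    open ≤-Reasoning
    u≤scaled : u ≤ suc (a + a) * suc n
    u≤scaled = begin
      u                       ≤⟨ u≤ ⟩
      a * suc n + a           ≤⟨ +-monoʳ-≤ (a * suc n) (m≤m*n a (suc n)) ⟩
      a * suc n + a * suc n   ≡⟨ sym (*-distribʳ-+ (suc n) a a) ⟩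
      (a + a) * suc n         ≤⟨ m≤n+m _ (suc n) ⟩
      suc (a + a) * suc n     ∎

-- The left side is the composite's running time when t = cT * n + cT bounds the
-- transducer's and ℓ is the length of its output.
composite-time : ∀ {f} → TimeBound f → Subhomogeneous f → ∀ cT cM → Σ ℕ λ K → ∀ n ℓ →
  ℓ ≤ suc (cT * n + cT) → (cT * n + cT) + suc (suc ℓ + suc ℓ) + (cM * f ℓ + cM) ≤ K * f n + K
composite-time {f} tb@(n≤f , _) sh cT cM with subhomogeneous-affine tb sh (suc cT)
... | b , f-affine = X + Y , bound
  where
  open +-*-Solver using (solve; _:=_; _:+_; _:*_; con)
  X Y : ℕ
  X = 3 * cT + cM * b
  Y = 3 * cT + 5 + cM * b + cM

  bound : ∀ n ℓ → ℓ ≤ suc (cT * n + cT) →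
    (cT * n + cT) + suc (suc ℓ + suc ℓ) + (cM * f ℓ + cM) ≤ (X + Y) * f n + (X + Y)
  bound n ℓ ℓ≤ = begin
    t + suc (suc ℓ + suc ℓ) + (cM * f ℓ + cM)
      ≤⟨ +-mono-≤ (+-mono-≤ t≤t′ (s≤s (+-mono-≤ sℓ≤ sℓ≤))) (+-monoˡ-≤ cM (*-monoʳ-≤ cM fℓ≤)) ⟩
    t′ + suc (suc (suc t′) + suc (suc t′)) + (cM * (b * f n + b) + cM)
      ≡⟨ solve 4 (λ c m b x → (c :* x :+ c) :+ (con 1 :+ ((con 2 :+ (c :* x :+ c)) :+ (con 2 :+ (c :* x :+ c))))
                              :+ (m :* (b :* x :+ b) :+ m)
                            := (con 3 :* c :+ m :* b) :* x :+ (con 3 :* c :+ con 5 :+ m :* b :+ m))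
                 refl cT cM b (f n) ⟩
    X * f n + Y
      ≤⟨ +-mono-≤ (*-monoˡ-≤ (f n) (m≤m+n X Y)) (m≤n+m Y X) ⟩
    (X + Y) * f n + (X + Y) ∎
    where
    open ≤-Reasoning
    t t′ : ℕ
    t = cT * n + cT
    t′ = cT * f n + cT
    t≤t′ : t ≤ t′
    t≤t′ = +-monoˡ-≤ cT (*-monoʳ-≤ cT (n≤f n))
    sℓ≤ : suc ℓ ≤ suc (suc t′)
    sℓ≤ = s≤s (≤-trans ℓ≤ (s≤s t≤t′))
    ℓ≤affine : ℓ ≤ suc cT * n + suc cT
    ℓ≤affine = begin
      ℓ                       ≤⟨ ℓ≤ ⟩
      suc (cT * n + cT)       ≡⟨ sym (+-suc (cT * n) cT) ⟩
      cT * n + suc cT         ≤⟨ +-monoˡ-≤ (suc cT) (m≤n+m (cT * n) n) ⟩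
      suc cT * n + suc cT     ∎
    fℓ≤ : f ℓ ≤ b * f n + b
    fℓ≤ = f-affine n ℓ ℓ≤affine

-- Closure under linear-time reductions

module Reduction {f : ℕ → ℕ} (tb : TimeBound f) (sh : Subhomogeneous f) (ρ : Word → Word)
  (T : DTM) (cT : ℕ) (computes : ∀ w → WithinD T w (cT * length w + cT) × outputD T w (cT * length w + cT) ≡ ρ w)
  (M : NTM) (cM : ℕ) (withinM : ∀ u → WithinN M u (cM * f (length u) + cM)) where
  open CompositeCorrect T M using (C; module AfterTransduction)

  C-accepts⇔ : ∀ w → AcceptsN C w ⇔ AcceptsN M (ρ w)
  C-accepts⇔ w = subst (λ u → AcceptsN C w ⇔ AcceptsN M u) (proj₂ (computes w))
    (AfterTransduction.AcceptsN-C⇔ w (cT * length w + cT) (proj₁ (computes w)))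

  C-within : Σ ℕ λ K → ∀ w → WithinN C w (K * f (length w) + K)
  C-within with composite-time tb sh cT cM
  ... | K , time = K , λ w →
    let t = cT * length w + cT
        open AfterTransduction w t (proj₁ (computes w))
    in WithinN-C (cM * f (length v) + cM) _ (withinM v) (time (length w) (length v) (length-outputD T w t))

≡true-cong : ∀ {b b′ : Bool} → b ≡ b′ → (b ≡ true) ⇔ (b′ ≡ true)
≡true-cong e = mk⇔ (trans (sym e)) (trans e)

NTIME-reduction-closed : ∀ {f} → TimeBound f → Subhomogeneous f → ∀ {B L} (ρ : Word → Word) →
  LinearTimeComputable ρ → (∀ w → L w ≡ B (ρ w)) → NTIME f B → NTIME f L
NTIME-reduction-closed tb sh ρ (T , cT , computes) L≡B∘ρ (M , M-accepts , cM , withinM) =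
  CompositeCorrect.C T M ,
  (λ w → ⇔.trans (≡true-cong (L≡B∘ρ w)) (⇔.trans (M-accepts (ρ w)) (⇔.sym (C-accepts⇔ w)))) , C-within
  where open Reduction tb sh ρ T cT computes M cM withinM

DTIME-reduction-closed : ∀ {f} → TimeBound f → Subhomogeneous f → ∀ {B L} (ρ : Word → Word) →
  LinearTimeComputable ρ → (∀ w → L w ≡ B (ρ w)) → DTIME f B → DTIME f L
DTIME-reduction-closed tb sh {B} ρ (T , cT , computes) L≡B∘ρ (D , D-accepts , cD , withinD) =
  CD , (λ w → ⇔.trans (≡true-cong (L≡B∘ρ w)) (⇔.trans (M-accepts (ρ w))
                (⇔.trans (⇔.sym (C-accepts⇔ w)) (CD-as-C.AcceptsN⇔AcceptsD w)))) ,
  proj₁ C-within , λ w → CD-as-C.WithinN⇒WithinD w _ (proj₂ C-within w)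
  where
  M : NTM
  M = asNTM D
  open AsNTM D using (AcceptsN⇔AcceptsD; WithinD⇒WithinN)
  M-accepts : ∀ u → (B u ≡ true) ⇔ AcceptsN M u
  M-accepts u = ⇔.trans (D-accepts u) (⇔.sym (AcceptsN⇔AcceptsD u))
  open Reduction tb sh ρ T cT computes M cD (λ u → WithinD⇒WithinN u _ (withinD u))
  open Composite T (DTM.k D) (DTM.g D) (DTM.q D) (DTM.start D) (DTM.accepting D)
    using (compositeD; compositeN-graph)
  CD : DTM
  CD = compositeD (DTM.δ D)
  module CD-as-C = Deterministic CD (NTM.δ (CompositeCorrect.C T M)) (compositeN-graph (DTM.δ D))

lemma6 : (f : ℕ → ℕ) → TimeBound f → Subhomogeneous f →
    (A : Language) → Complete f A →
    ((DTIME f ≐ NTIME f) ⇔ DTIME f A) × ((NTIME f ≐ coNTIME f) ⇔ coNTIME f A)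
lemma6 f tb sh A (A∈NTIME , reduce) =
  mk⇔ (λ D≐N → Equivalence.from (D≐N A) A∈NTIME) D≐N-from-A ,
  mk⇔ (λ N≐coN → Equivalence.to (N≐coN A) A∈NTIME) N≐coN-from-A
  where
  D≐N-from-A : DTIME f A → DTIME f ≐ NTIME f
  D≐N-from-A A∈DTIME L = mk⇔ (DTIME⊆NTIME f L) λ L∈NTIME →
    let ρ , computable , L≡A∘ρ = reduce L L∈NTIME
    in DTIME-reduction-closed tb sh ρ computable L≡A∘ρ A∈DTIME

  N≐coN-from-A : coNTIME f A → NTIME f ≐ coNTIME f
  N≐coN-from-A A∈coNTIME L = mk⇔
    (λ L∈NTIME → let ρ , computable , L≡A∘ρ = reduce L L∈NTIME
      in NTIME-reduction-closed tb sh ρ computable (λ w → cong not (L≡A∘ρ w)) A∈coNTIME)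
    (λ L∈coNTIME → let ρ , computable , L̄≡A∘ρ = reduce (not ∘ L) L∈coNTIME
      in NTIME-reduction-closed tb sh ρ computable
           (λ w → trans (sym (not-involutive (L w))) (cong not (L̄≡A∘ρ w))) A∈coNTIME)
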